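{- Let $n>1$ be an integer and $m=2n$. Then every term of $S_m$ that is less than $2n^2+3n-2$ lies in $\{0,1,\ldots,2n\}$.
   Context: For an integer $m\ge3$, $S_m$ is the sequence defined greedily by $a_0=0$ and, having chosen $a_0,\ldots,a_k$, $a_{k+1}$ is the least integer greater than $a_k$ such that there are no distinct $x_1,\ldots,x_m\in\{a_0,\ldots,a_{k+1}\}$ with $x_1+\cdots+x_{m-1}=(m-1)x_m$. -}

module Defs where

open import Data.Nat using (ℕ; zero; suc; _+_; _*_; _≤_; _<_)
open import Data.Fin using (Fin)
import Data.Fin as F
open import Data.Product using (Σ; ∃; _×_)
open import Data.Sum using (_⊎_)
open import Data.Empty using (⊥)
open import Relation.Nullary using (¬_)
open import Relation.Binary.PropositionalEquality using (_≡_; _≢_)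
open import Function.Definitions using (Injective)

sumF : ∀ {p} → (Fin p → ℕ) → ℕ
sumF {zero}  x = 0
sumF {suc p} x = x F.zero + sumF (λ i → x (F.suc i))

InPrefix : (ℕ → ℕ) → ℕ → ℕ → Set
InPrefix a j z = Σ ℕ λ i → i ≤ j × z ≡ a i

-- A set A (as a predicate on ℕ) contains distinct x_1,...,x_m with
-- x_1 + ... + x_{m-1} = (m-1) x_m.  Here m = suc p, the first m-1
-- elements are xs : Fin p → ℕ and x_m is y.
HasSolution : ℕ → (ℕ → Set) → Set
HasSolution zero    A = ⊥   -- m = 0: never used (m ≥ 3 in all uses)
HasSolution (suc p) A =
  Σ (Fin p → ℕ) λ xs → Σ ℕ λ y →
    Injective _≡_ _≡_ xs × (∀ i → xs i ≢ y) ×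
    (∀ i → A (xs i)) × A y ×
    sumF xs ≡ p * y

Free : ℕ → (ℕ → Set) → Set
Free m A = ¬ HasSolution m A

-- a 0, ..., a K are the first K+1 terms of the greedy sequence S_m:
-- a 0 = 0, and for each k < K, a (k+1) is the least integer > a k such
-- that {a 0, ..., a (k+1)} is free.
GreedyPrefix : ℕ → (ℕ → ℕ) → ℕ → Set
GreedyPrefix m a K =
  a 0 ≡ 0 ×
  (∀ k → k < K →
     a k < a (suc k) ×
     Free m (InPrefix a (suc k)) ×
     (∀ y → a k < y → y < a (suc k) →
        ¬ Free m (λ z → InPrefix a k z ⊎ z ≡ y)))

-- The first terms of the greedy sequence S_{2n}.  Write m = 2n; a solution
-- is m distinct numbers x₁, …, x_{m-1}, y with x₁ + ⋯ + x_{m-1} + y = m·y.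
--
-- (1) {0, …, 2n} is free: m distinct entries in {0, …, m} miss exactly one
--     value z ≠ y, so m·y + z = 0 + 1 + ⋯ + m = n(2n+1), which comparing y
--     with n rules out.  Hence S_{2n} starts 0, 1, …, 2n.
-- (2) Any y with 2n < y < 2n² + 3n - 2 makes {0, …, 2n, y} non-free:
--     dividing D = y + n(2n+1) by m gives distinct t, u, v ≤ m with
--     D = m·t + u + v, and y with {0, …, m} ∖ {t, u, v} averages to t.
-- (3) The greedy sequence increases, so a term a_k < 2n² + 3n - 2 with
--     k > 2n puts a_{2n+1} in the range of (2), contradicting freeness.
module Submission where

open import Defs
open import Data.Nat using (ℕ; zero; suc; _+_; _*_; _∸_; _≤_; _<_; z≤n; s≤s; s≤s⁻¹; _≟_; _≤?_)
open import Data.Nat.Properties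
open import Data.Nat.DivMod using (_/_; _%_; m≡m%n+[m/n]*n; m%n<n)
open import Data.Nat.Tactic.RingSolver using (solve-∀)
open import Data.Fin as F using (Fin; toℕ; fromℕ<; punchIn; punchOut)
open import Data.Fin.Properties
  using (toℕ-injective; toℕ-fromℕ<; toℕ<n; punchIn-injective; punchInᵢ≢i; punchIn-punchOut; any?; injective⇒≤)
open import Data.Vec.Functional using (_∷_)
open import Data.Product using (Σ; ∃; _×_; _,_; proj₁; proj₂)
open import Data.Sum using (_⊎_; inj₁; inj₂)
open import Data.Empty using (⊥-elim)
open import Relation.Nullary using (¬_; Dec; yes; no)
open import Relation.Binary.Definitions using (tri<; tri≈; tri>)
open import Relation.Binary.PropositionalEquality
open import Function using (_∘_)
open import Function.Definitions using (Injective)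

tri : ℕ → ℕ
tri zero    = 0
tri (suc N) = N + tri N

twice-tri : ∀ k → 2 * tri (suc k) ≡ k * suc k
twice-tri zero    = refl
twice-tri (suc k) = begin
  2 * (suc k + tri (suc k))    ≡⟨ *-distribˡ-+ 2 (suc k) (tri (suc k)) ⟩
  2 * suc k + 2 * tri (suc k)  ≡⟨ cong (2 * suc k +_) (twice-tri k) ⟩
  2 * suc k + k * suc k        ≡⟨ regroup k ⟩
  suc k * suc (suc k)          ∎
  where
  open ≡-Reasoning
  regroup : ∀ k → 2 * suc k + k * suc k ≡ suc k * suc (suc k)
  regroup = solve-∀

tri-odd : ∀ n → tri (suc (2 * n)) ≡ 2 * (n * n) + n
tri-odd n = *-cancelˡ-≡ _ _ 2 (trans (twice-tri (2 * n)) (expand n))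
  where
  expand : ∀ n → 2 * n * suc (2 * n) ≡ 2 * (2 * (n * n) + n)
  expand = solve-∀

sumF-punchIn : ∀ {p} (g : Fin (suc p) → ℕ) (i : Fin (suc p)) →
  sumF g ≡ g i + sumF (g ∘ punchIn i)
sumF-punchIn g F.zero = refl
sumF-punchIn {suc p} g (F.suc i) = begin
  g F.zero + sumF (g ∘ F.suc)    ≡⟨ cong (g F.zero +_) (sumF-punchIn (g ∘ F.suc) i) ⟩
  g F.zero + (g (F.suc i) + rest) ≡⟨ sym (+-assoc (g F.zero) _ rest) ⟩
  (g F.zero + g (F.suc i)) + rest ≡⟨ cong (_+ rest) (+-comm (g F.zero) (g (F.suc i))) ⟩
  (g (F.suc i) + g F.zero) + rest ≡⟨ +-assoc (g (F.suc i)) _ rest ⟩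
  g (F.suc i) + (g F.zero + rest) ∎
  where
  open ≡-Reasoning
  rest = sumF (g ∘ F.suc ∘ punchIn i)

delete-injective : ∀ {M} (g : Fin (suc M) → ℕ) → Injective _≡_ _≡_ g →
  (i : Fin (suc M)) → Injective _≡_ _≡_ (g ∘ punchIn i)
delete-injective g inj i e = punchIn-injective i _ _ (inj e)

∷-injective : ∀ {M y} {g : Fin M → ℕ} → (∀ i → g i ≢ y) →
  Injective _≡_ _≡_ g → Injective _≡_ _≡_ (y ∷ g)
∷-injective fresh inj {F.zero}  {F.zero}  _ = refl
∷-injective fresh inj {F.zero}  {F.suc j} e = ⊥-elim (fresh j (sym e))
∷-injective fresh inj {F.suc i} {F.zero}  e = ⊥-elim (fresh i e)
∷-injective fresh inj {F.suc i} {F.suc j} e = cong F.suc (inj e)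

below-avoiding : ∀ {M N} (g : Fin M → ℕ) → (∀ i → g i < suc N) →
  ¬ (∃ λ i → g i ≡ N) → ∀ i → g i < N
below-avoiding g below N∉g i with m<1+n⇒m<n∨m≡n (below i)
... | inj₁ gi<N = gi<N
... | inj₂ gi≡N = ⊥-elim (N∉g (i , gi≡N))

delete-top : ∀ {M N} (g : Fin (suc M) → ℕ) → Injective _≡_ _≡_ g →
  (∀ i → g i < suc N) → (i : Fin (suc M)) → g i ≡ N → ∀ j → g (punchIn i j) < N
delete-top g inj below i gi≡N =
  below-avoiding (g ∘ punchIn i) (below ∘ punchIn i)
    (λ (j , e) → punchInᵢ≢i i j (inj (trans e (sym gi≡N))))

distinct-below⇒≤ : ∀ {M} N (g : Fin M → ℕ) → Injective _≡_ _≡_ g →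
  (∀ i → g i < N) → M ≤ N
distinct-below⇒≤ N g inj below = injective⇒≤ {f = λ i → fromℕ< (below i)} fin-injective
  where
  fin-injective : Injective _≡_ _≡_ (λ i → fromℕ< (below i))
  fin-injective {i} {j} e =
    inj (trans (sym (toℕ-fromℕ< (below i))) (trans (cong toℕ e) (toℕ-fromℕ< (below j))))

sum-distinct-below : ∀ N (g : Fin N → ℕ) → Injective _≡_ _≡_ g →
  (∀ i → g i < N) → sumF g ≡ tri N
sum-distinct-below zero    g inj below = refl
sum-distinct-below (suc N) g inj below with any? (λ i → g i ≟ N)
... | yes (i , gi≡N) = trans (sumF-punchIn g i)
        (cong₂ _+_ gi≡N (sum-distinct-below N (g ∘ punchIn i)
          (delete-injective g inj i) (delete-top g inj below i gi≡N)))
... | no N∉g = ⊥-elim (1+n≰n (distinct-below⇒≤ N g inj (below-avoiding g below N∉g)))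

missing-value : ∀ N (g : Fin N → ℕ) → Injective _≡_ _≡_ g → (∀ i → g i < suc N) →
  ∃ λ z → z < suc N × (∀ i → g i ≢ z) × sumF g + z ≡ tri (suc N)
missing-value zero g inj below = 0 , s≤s z≤n , (λ ()) , refl
missing-value (suc N) g inj below with any? (λ i → g i ≟ suc N)
... | no N+1∉g = suc N , ≤-refl , (λ i → <⇒≢ (avoids i)) ,
        trans (cong (_+ suc N) (sum-distinct-below (suc N) g inj avoids)) (+-comm (tri (suc N)) (suc N))
  where
  avoids : ∀ i → g i < suc N
  avoids = below-avoiding g below N+1∉g
... | yes (i , gi≡N+1)
  with missing-value N (g ∘ punchIn i) (delete-injective g inj i) (delete-top g inj below i gi≡N+1)
...   | z , z<N+1 , missed , total = z , m≤n⇒m≤1+n z<N+1 , missed-by-g , sum-eq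
  where
  missed-by-g : ∀ j → g j ≢ z
  missed-by-g j gj≡z with i F.≟ j
  ... | yes refl = <⇒≢ z<N+1 (trans (sym gj≡z) gi≡N+1)
  ... | no i≢j   = missed (punchOut i≢j) (trans (cong g (punchIn-punchOut i≢j)) gj≡z)
  sum-eq : sumF g + z ≡ tri (suc (suc N))
  sum-eq = begin
    sumF g + z                                 ≡⟨ cong (_+ z) (sumF-punchIn g i) ⟩
    (g i + sumF (g ∘ punchIn i)) + z           ≡⟨ +-assoc (g i) _ z ⟩
    g i + (sumF (g ∘ punchIn i) + z)           ≡⟨ cong₂ _+_ gi≡N+1 total ⟩
    suc N + tri (suc N)                        ∎
    where open ≡-Reasoning

record Enumeration (M : ℕ) (P : ℕ → Set) : Set where
  field
    elem     : Fin M → ℕ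
    distinct : Injective _≡_ _≡_ elem
    sound    : ∀ i → P (elem i)
    complete : ∀ {z} → P z → ∃ λ i → elem i ≡ z
open Enumeration

segment : ∀ N → Enumeration N (_< N)
segment N = record
  { elem     = toℕ
  ; distinct = toℕ-injective
  ; sound    = toℕ<n
  ; complete = λ z<N → fromℕ< z<N , toℕ-fromℕ< z<N
  }

segment-sum : ∀ N → sumF (elem (segment N)) ≡ tri N
segment-sum N = sum-distinct-below N toℕ toℕ-injective toℕ<n

remove : ∀ {M P x} (E : Enumeration (suc M) P) → P x →
  Σ (Enumeration M (λ z → P z × z ≢ x)) λ E′ → sumF (elem E) ≡ x + sumF (elem E′)
remove {M} {P} {x} E Px with complete E Px
... | i , gi≡x = E′ , trans (sumF-punchIn g i) (cong (_+ sumF (g ∘ punchIn i)) gi≡x)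
  where
  g = elem E
  complete′ : ∀ {z} → P z × z ≢ x → ∃ λ j → g (punchIn i j) ≡ z
  complete′ (Pz , z≢x) with complete E Pz
  ... | k , gk≡z with i F.≟ k
  ...   | yes refl = ⊥-elim (z≢x (trans (sym gk≡z) gi≡x))
  ...   | no i≢k   = punchOut i≢k , trans (cong g (punchIn-punchOut i≢k)) gk≡z
  E′ : Enumeration M (λ z → P z × z ≢ x)
  E′ = record
    { elem     = g ∘ punchIn i
    ; distinct = delete-injective g (distinct E) i
    ; sound    = λ j → sound E (punchIn i j) ,
                       λ e → punchInᵢ≢i i j (distinct E (trans e (sym gi≡x)))
    ; complete = complete′
    }

insert : ∀ {M P y} → Enumeration M P → ¬ P y → Enumeration (suc M) (λ z → z ≡ y ⊎ P z)
insert {P = P} {y} E ¬Py = record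
  { elem     = y ∷ elem E
  ; distinct = ∷-injective (λ i e → ¬Py (subst P e (sound E i))) (distinct E)
  ; sound    = λ { F.zero → inj₁ refl ; (F.suc i) → inj₂ (sound E i) }
  ; complete = λ { (inj₁ refl) → F.zero , refl
                 ; (inj₂ Pz) → F.suc (proj₁ (complete E Pz)) , proj₂ (complete E Pz) }
  }

-- Part (1): the segment {0, …, 2n} is free.

segment-solution : ∀ m (A : ℕ → Set) → (∀ z → A z → z ≤ m) → HasSolution m A →
  ∃ λ y → ∃ λ z → z ≤ m × z ≢ y × m * y + z ≡ tri (suc m)
segment-solution (suc p) A bounded (xs , y , inj , xs≢y , A-xs , Ay , sum≡) =
  let (z , z<m+1 , missed , total) = missing-value (suc p) (y ∷ xs) (∷-injective xs≢y inj) below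
  in y , z , s≤s⁻¹ z<m+1 , (λ z≡y → missed F.zero (sym z≡y)) ,
     trans (cong (λ s → y + s + z) (sym sum≡)) total
  where
  below : ∀ i → (y ∷ xs) i < suc (suc p)
  below F.zero    = s≤s (bounded y Ay)
  below (F.suc i) = s≤s (bounded (xs i) (A-xs i))

-- For m = 2n the equation m·y + z = n(2n + 1) has no solution with z ≤ m,
-- z ≠ y: y < n makes the left side too small, y > n too large, and y = n
-- forces z = n = y.
even-segment-equation : ∀ n y z → 0 < n → z ≤ 2 * n → z ≢ y →
  2 * n * y + z ≢ 2 * (n * n) + n
even-segment-equation n y z 0<n z≤2n z≢y eq with <-cmp y n
... | tri< y<n _ _ = <-irrefl eq (begin-strict
    2 * n * y + z         ≤⟨ +-monoʳ-≤ (2 * n * y) z≤2n ⟩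
    2 * n * y + 2 * n     ≡⟨ +-comm (2 * n * y) (2 * n) ⟩
    2 * n + 2 * n * y     ≡⟨ *-suc (2 * n) y ⟨
    2 * n * suc y         ≤⟨ *-monoʳ-≤ (2 * n) y<n ⟩
    2 * n * n             ≡⟨ *-assoc 2 n n ⟩
    2 * (n * n)           <⟨ m<m+n (2 * (n * n)) 0<n ⟩
    2 * (n * n) + n       ∎)
  where open ≤-Reasoning
... | tri≈ _ refl _ = z≢y (+-cancelˡ-≡ (2 * (n * n)) z y (trans (cong (_+ z) (sym (*-assoc 2 y y))) eq))
... | tri> _ _ n<y = <-irrefl (sym eq) (begin-strict
    2 * (n * n) + n       <⟨ +-monoʳ-< (2 * (n * n)) (m<m+n n 0<n) ⟩
    2 * (n * n) + (n + n) ≡⟨ cong (λ w → 2 * (n * n) + (n + w)) (+-identityʳ n) ⟨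
    2 * (n * n) + 2 * n   ≡⟨ cong (_+ 2 * n) (sym (*-assoc 2 n n)) ⟩
    2 * n * n + 2 * n     ≡⟨ +-comm (2 * n * n) (2 * n) ⟩
    2 * n + 2 * n * n     ≡⟨ *-suc (2 * n) n ⟨
    2 * n * suc n         ≤⟨ *-monoʳ-≤ (2 * n) n<y ⟩
    2 * n * y             ≤⟨ m≤m+n (2 * n * y) z ⟩
    2 * n * y + z         ∎)
  where open ≤-Reasoning

even-segment-free : ∀ n (A : ℕ → Set) → 0 < n → (∀ z → A z → z ≤ 2 * n) → Free (2 * n) A
even-segment-free n A 0<n bounded sol =
  let (y , z , z≤2n , z≢y , eq) = segment-solution (2 * n) A bounded sol
  in even-segment-equation n y z 0<n z≤2n z≢y (trans eq (tri-odd n))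

-- Part (2): extending {0, …, 2n} by a small y.

record Decomposition (m D : ℕ) : Set where
  field
    t u v    : ℕ
    t≤m      : t ≤ m
    u≤m      : u ≤ m
    v≤m      : v ≤ m
    u≢t      : u ≢ t
    v≢t      : v ≢ t
    v≢u      : v ≢ u
    equation : D ≡ m * t + (u + v)

-- If y > m and y + tri (m + 1) = m·t + u + v as above, then the m - 1
-- numbers y and {0, …, m} ∖ {t, u, v} sum to (m - 1)·t: a solution with
-- average t, inside any A containing y and {0, …, m}.
decomposition-solution : ∀ M (A : ℕ → Set) y → (∀ z → z ≤ suc (suc M) → A z) → A y →
  suc (suc M) < y → Decomposition (suc (suc M)) (y + tri (3 + M)) →
  HasSolution (suc (suc M)) A
decomposition-solution M A y segment⊆A Ay m<y d =
  elem E₄ , t , distinct E₄ , avoids-t , in-A , segment⊆A t t≤m , average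
  where
  open Decomposition d
  m = suc (suc M)
  R₁ = remove (segment (suc m)) (s≤s t≤m)
  E₁ = proj₁ R₁
  R₂ = remove E₁ (s≤s u≤m , u≢t)
  E₂ = proj₁ R₂
  R₃ = remove E₂ ((s≤s v≤m , v≢t) , v≢u)
  E₃ = proj₁ R₃
  E₄ = insert E₃ (λ (((y<m+1 , _) , _) , _) → <⇒≱ m<y (s≤s⁻¹ y<m+1))
  rest = sumF (elem E₃)

  avoids-t : ∀ i → elem E₄ i ≢ t
  avoids-t i with sound E₄ i
  ... | inj₁ e = λ z≡t → <⇒≱ m<y (subst (_≤ m) (trans (sym z≡t) e) t≤m)
  ... | inj₂ (((_ , z≢t) , _) , _) = z≢t

  in-A : ∀ i → A (elem E₄ i)
  in-A i with sound E₄ i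
  ... | inj₁ e = subst A (sym e) Ay
  ... | inj₂ (((z<m+1 , _) , _) , _) = segment⊆A _ (s≤s⁻¹ z<m+1)

  total : tri (suc m) ≡ t + (u + (v + rest))
  total = begin
    tri (suc m)                              ≡⟨ sym (segment-sum (suc m)) ⟩
    sumF (elem (segment (suc m)))            ≡⟨ proj₂ R₁ ⟩
    t + sumF (elem E₁)                       ≡⟨ cong (t +_) (proj₂ R₂) ⟩
    t + (u + sumF (elem E₂))                 ≡⟨ cong (λ s → t + (u + s)) (proj₂ R₃) ⟩
    t + (u + (v + rest))                     ∎
    where open ≡-Reasoning

  average : y + rest ≡ suc M * t
  average = +-cancelʳ-≡ (t + (u + v)) (y + rest) (suc M * t) (begin
    (y + rest) + (t + (u + v))        ≡⟨ regroup₁ y rest t u v ⟩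
    y + (t + (u + (v + rest)))        ≡⟨ cong (y +_) (sym total) ⟩
    y + tri (suc m)                   ≡⟨ equation ⟩
    m * t + (u + v)                   ≡⟨ regroup₂ M t (u + v) ⟩
    suc M * t + (t + (u + v))         ∎)
    where
    open ≡-Reasoning
    regroup₁ : ∀ y s t u v → (y + s) + (t + (u + v)) ≡ y + (t + (u + (v + s)))
    regroup₁ = solve-∀
    regroup₂ : ∀ M t w → suc (suc M) * t + w ≡ suc M * t + (t + w)
    regroup₂ = solve-∀

top-decomposition : ∀ m r → 2 + r < m → Decomposition m (r + suc m * m)
top-decomposition (suc k) r (s≤s r+1<k) = record
  { t = suc k ; u = suc r ; v = k
  ; t≤m = ≤-refl ; u≤m = m≤n⇒m≤1+n (<⇒≤ r+1<k) ; v≤m = n≤1+n k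
  ; u≢t = <⇒≢ (m<n⇒m<1+n r+1<k) ; v≢t = <⇒≢ (n<1+n k) ; v≢u = >⇒≢ r+1<k
  ; equation = expand r k
  }
  where
  expand : ∀ r k → r + suc (suc k) * suc k ≡ suc k * suc k + (suc r + k)
  expand = solve-∀

exact-decomposition : ∀ m q → 2 ≤ q → q < m → Decomposition m (0 + suc q * m)
exact-decomposition m q 2≤q q<m = record
  { t = q ; u = 0 ; v = m
  ; t≤m = <⇒≤ q<m ; u≤m = z≤n ; v≤m = ≤-refl
  ; u≢t = <⇒≢ (<-trans (s≤s z≤n) 2≤q) ; v≢t = >⇒≢ q<m ; v≢u = >⇒≢ (≤-<-trans z≤n q<m)
  ; equation = expand q m
  }
  where
  expand : ∀ q m → 0 + suc q * m ≡ m * q + (0 + m)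
  expand = solve-∀

generic-decomposition : ∀ m q r → q < m → r < m → r ≢ 0 → r ≢ suc q →
  Decomposition m (r + suc q * m)
generic-decomposition m q r q<m r<m r≢0 r≢q+1 = record
  { t = suc q ; u = 0 ; v = r
  ; t≤m = q<m ; u≤m = z≤n ; v≤m = <⇒≤ r<m
  ; u≢t = λ () ; v≢t = r≢q+1 ; v≢u = r≢0
  ; equation = expand r q m
  }
  where
  expand : ∀ r q m → r + suc q * m ≡ m * suc q + (0 + r)
  expand = solve-∀

diagonal-decomposition : ∀ m q → 2 ≤ q → q < m → Decomposition m (suc q + suc q * m)
diagonal-decomposition m q 2≤q q<m = record
  { t = suc q ; u = 1 ; v = q
  ; t≤m = q<m ; u≤m = ≤-<-trans z≤n q<m ; v≤m = <⇒≤ q<m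
  ; u≢t = λ e → <⇒≢ (<-trans (s≤s z≤n) 2≤q) (suc-injective e)
  ; v≢t = <⇒≢ (n<1+n q) ; v≢u = >⇒≢ 2≤q
  ; equation = expand q m
  }
  where
  expand : ∀ q m → suc q + suc q * m ≡ m * suc q + (1 + q)
  expand = solve-∀

decomposition-from-division : ∀ m q r → 3 ≤ q → q ≤ suc m → r < m →
  (q ≡ suc m → 2 + r < m) → Decomposition m (r + q * m)
decomposition-from-division m q r 3≤q q≤m+1 r<m top with m≤n⇒m<n∨m≡n q≤m+1
... | inj₂ refl = top-decomposition m r (top refl)
decomposition-from-division m (suc q) r (s≤s 2≤q) _ r<m _ | inj₁ (s≤s q<m)
  with r ≟ 0 | r ≟ suc q
... | yes refl | _        = exact-decomposition m q 2≤q q<m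
... | no r≢0   | no r≢q+1 = generic-decomposition m q r q<m r<m r≢0 r≢q+1
... | no _     | yes refl = diagonal-decomposition m q 2≤q q<m

-- Every D with 3m ≤ D and D + 2 < (m + 2)·m has a decomposition: these
-- bounds place the quotient of D by m in {3, …, m + 1}, with remainder
-- r + 2 < m when the quotient is m + 1.
decompose : ∀ m D → 3 * m ≤ D → 2 + D < (2 + m) * m → Decomposition m D
decompose zero D _ ()
decompose m@(suc _) D lower upper =
  subst (Decomposition m) (sym division)
    (decomposition-from-division m q r 3≤q q≤m+1 r<m top)
  where
  open ≤-Reasoning
  q = D / m
  r = D % m
  division : D ≡ r + q * m
  division = m≡m%n+[m/n]*n D m
  r<m : r < m
  r<m = m%n<n D m
  3≤q : 3 ≤ q
  3≤q = s≤s⁻¹ (*-cancelʳ-< m 3 (suc q) (begin-strict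
    3 * m      ≤⟨ lower ⟩
    D          ≡⟨ division ⟩
    r + q * m  <⟨ +-monoˡ-< (q * m) r<m ⟩
    suc q * m  ∎))
  q≤m+1 : q ≤ suc m
  q≤m+1 = s≤s⁻¹ (*-cancelʳ-< m q (2 + m) (begin-strict
    q * m        ≤⟨ m≤n+m (q * m) r ⟩
    r + q * m    ≡⟨ division ⟨
    D            ≤⟨ m≤n+m D 2 ⟩
    2 + D        <⟨ upper ⟩
    (2 + m) * m  ∎))
  top : q ≡ suc m → 2 + r < m
  top q≡m+1 = +-cancelʳ-< (suc m * m) (2 + r) m (begin-strict
    2 + r + suc m * m  ≡⟨ cong (λ k → 2 + (r + k * m)) q≡m+1 ⟨
    2 + (r + q * m)    ≡⟨ cong (2 +_) division ⟨
    2 + D              <⟨ upper ⟩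
    (2 + m) * m        ∎)

small-extension-solution : ∀ n → 1 < n → (A : ℕ → Set) → ∀ y → 2 * n < y →
  2 + y < 2 * (n * n) + 3 * n → A y → (∀ z → z ≤ 2 * n → A z) → HasSolution (2 * n) A
small-extension-solution n 2≤n@(s≤s (s≤s z≤n)) A y m<y y+2<bound Ay segment⊆A =
  decomposition-solution _ A y segment⊆A Ay m<y (decompose (2 * n) D lower upper)
  where
  open ≤-Reasoning
  D = y + tri (suc (2 * n))
  lower : 3 * (2 * n) ≤ D
  lower = begin
    3 * (2 * n)                ≡⟨ split n ⟩
    2 * n + 2 * (2 * n)        ≤⟨ +-mono-≤ (<⇒≤ m<y) (≤-trans (*-monoʳ-≤ 2 (*-monoˡ-≤ n 2≤n)) (m≤m+n _ n)) ⟩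
    y + (2 * (n * n) + n)      ≡⟨ cong (y +_) (tri-odd n) ⟨
    D                          ∎
    where
    split : ∀ n → 3 * (2 * n) ≡ 2 * n + 2 * (2 * n)
    split = solve-∀
  upper : 2 + D < (2 + 2 * n) * (2 * n)
  upper = begin-strict
    2 + D                                     ≡⟨ cong (λ s → 2 + (y + s)) (tri-odd n) ⟩
    (2 + y) + (2 * (n * n) + n)               <⟨ +-monoˡ-< (2 * (n * n) + n) y+2<bound ⟩
    (2 * (n * n) + 3 * n) + (2 * (n * n) + n) ≡⟨ collect n ⟩
    (2 + 2 * n) * (2 * n)                     ∎
    where
    collect : ∀ n → (2 * (n * n) + 3 * n) + (2 * (n * n) + n) ≡ (2 + 2 * n) * (2 * n)
    collect = solve-∀

-- Part (3): the greedy sequence.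

greedy-monotone : ∀ {m a K} → GreedyPrefix m a K → ∀ {i} j → i ≤ j → j ≤ K → a i ≤ a j
greedy-monotone greedy zero    z≤n _ = ≤-refl
greedy-monotone greedy (suc j) i≤1+j 1+j≤K with m≤n⇒m<n∨m≡n i≤1+j
... | inj₂ refl  = ≤-refl
... | inj₁ i<1+j = ≤-trans (greedy-monotone greedy j (s≤s⁻¹ i<1+j) (<⇒≤ 1+j≤K))
                           (<⇒≤ (proj₁ (proj₂ greedy j 1+j≤K)))

-- If every subset of {0, …, B} is free, the greedy sequence starts
-- 0, 1, …, B: the candidate j + 1 ≤ B keeps the prefix inside {0, …, B},
-- so the greedy choice cannot skip it.
greedy-initial : ∀ {m a K} B → (∀ A → (∀ z → A z → z ≤ B) → Free m A) →
  GreedyPrefix m a K → ∀ j → j ≤ K → j ≤ B → a j ≡ j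
greedy-initial B segment-free greedy zero _ _ = proj₁ greedy
greedy-initial {a = a} B segment-free greedy (suc j) 1+j≤K 1+j≤B =
  ≤-antisym (≮⇒≥ not-above) (subst (_< a (suc j)) aj≡j increasing)
  where
  aj≡j : a j ≡ j
  aj≡j = greedy-initial B segment-free greedy j (<⇒≤ 1+j≤K) (<⇒≤ 1+j≤B)
  increasing = proj₁ (proj₂ greedy j 1+j≤K)
  minimal = proj₂ (proj₂ (proj₂ greedy j 1+j≤K))
  extension-bounded : ∀ z → InPrefix a j z ⊎ z ≡ suc j → z ≤ B
  extension-bounded _ (inj₁ (i , i≤j , refl)) =
    ≤-trans (greedy-monotone greedy j i≤j (<⇒≤ 1+j≤K)) (subst (_≤ B) (sym aj≡j) (<⇒≤ 1+j≤B))
  extension-bounded _ (inj₂ refl) = 1+j≤B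
  not-above : ¬ (suc j < a (suc j))
  not-above above = minimal (suc j) (subst (_< suc j) (sym aj≡j) ≤-refl) above
    (segment-free _ extension-bounded)

-- The terms a_0, …, a_{2n} are 0, …, 2n by (1); a later term a_k lies above
-- y = a_{2n+1}, and a_k below the bound would put y in the range of (2),
-- contradicting the freeness of {a_0, …, a_{2n+1}}.
lemma7 : (n : ℕ) → 1 < n → (a : ℕ → ℕ) → (K : ℕ) →
    GreedyPrefix (2 * n) a K → (k : ℕ) → k ≤ K →
    a k < (2 * (n * n) + 3 * n) ∸ 2 → a k ≤ 2 * n
lemma7 n 1<n@(s≤s (s≤s z≤n)) a K greedy k k≤K ak<bound = bounded (k ≤? m)
  where
  m = 2 * n
  initial : ∀ j → j ≤ K → j ≤ m → a j ≡ j
  initial = greedy-initial m (λ A → even-segment-free n A (s≤s z≤n)) greedy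
  bounded : Dec (k ≤ m) → a k ≤ m
  bounded (yes k≤m) = subst (_≤ m) (sym (initial k k≤K k≤m)) k≤m
  bounded (no k≰m) = ⊥-elim (next-prefix-free
      (small-extension-solution n 1<n _ y m<y y+2<bound (suc m , ≤-refl , refl) segment⊆prefix))
    where
    m<k = ≰⇒> k≰m
    m<K = <-≤-trans m<k k≤K
    y = a (suc m)
    next-prefix-free = proj₁ (proj₂ (proj₂ greedy m m<K))
    m<y : m < y
    m<y = subst (_< y) (initial m (<⇒≤ m<K) ≤-refl) (proj₁ (proj₂ greedy m m<K))
    y+2<bound : 2 + y < 2 * (n * n) + 3 * n
    y+2<bound = ≤-<-trans (+-monoʳ-≤ 2 (greedy-monotone greedy k m<k k≤K))
      (subst (_< 2 * (n * n) + 3 * n) (+-comm (a k) 2)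
        (m≤o∸n⇒m+n≤o (suc (a k)) (s≤s (s≤s z≤n)) ak<bound))
    segment⊆prefix : ∀ z → z ≤ m → InPrefix a (suc m) z
    segment⊆prefix z z≤m = z , m≤n⇒m≤1+n z≤m , sym (initial z (≤-trans z≤m (<⇒≤ m<K)) z≤m)
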